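{- Let $C$ be a $\Sigma_3(t,r)$-formula computing a Boolean function $f\colon\{0,1\}^n\to\{0,1\}$. Then $f$ can be encoded by a CNF with $\lceil\log_2 t\rceil$ non-deterministic variables and at most $r$ clauses. If instead $C$ is a $\Sigma_3(t,r)$-circuit computing $f$, then $f$ can be encoded by a CNF with $\lceil\log_2 t\rceil$ non-deterministic variables and at most $2rt$ clauses.
   Context: A CNF $F(x_1,\dots,x_n,y_1,\dots,y_s)$ encodes $f$ if for every $x\in\{0,1\}^n$, $f(x)=1$ if and only if there exists $y\in\{0,1\}^s$ with $F(x,y)=1$; the $y_i$ are the non-deterministic variables, and the size of a CNF is its number of clauses. A $\Sigma_3$-circuit is a depth-3 circuit whose inputs are variables and their negations, whose output gate is an OR, whose gates on the second layer are ANDs, and whose gates on the third (bottom) layer are ORs of literals; i.e. it is an OR of CNFs which may share clauses. A $\Sigma_3$-formula is a $\Sigma_3$-circuit in which every gate has out-degree one. A $\Sigma_3(t,r)$-circuit (resp. formula) is a $\Sigma_3$-circuit (resp. formula) with at most $t$ AND gates on the second layer and at most $r$ OR gates on the third layer. -}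

module Defs where

open import Data.Nat using (ℕ; _≤_)
open import Data.Fin using (Fin)
open import Data.Bool using (Bool; true; false; not; _∨_; if_then_else_)
open import Data.List using (List; allFin)
open import Data.Bool.ListAction using (any; all)
open import Data.Product using (_×_; Σ; ∃; _,_)
open import Data.Sum using (_⊎_; [_,_])
open import Relation.Binary.PropositionalEquality using (_≡_)
open import Function.Bundles using (_⇔_)

Literal : Set → Set
Literal V = V × Bool

evalLit : {V : Set} → (V → Bool) → Literal V → Bool
evalLit ρ (v , b) = if b then ρ v else not (ρ v)

Clause : Set → Set
Clause V = List (Literal V)

evalClause : {V : Set} → (V → Bool) → Clause V → Bool
evalClause ρ c = any (evalLit ρ) c

CNF : Set → Set
CNF V = List (Clause V)

evalCNF : {V : Set} → (V → Bool) → CNF V → Bool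
evalCNF ρ F = all (evalClause ρ) F

BoolFun : ℕ → Set
BoolFun n = (Fin n → Bool) → Bool

Encodes : {n s : ℕ} → BoolFun n → CNF (Fin n ⊎ Fin s) → Set
Encodes {n} {s} f F =
  (x : Fin n → Bool) → (f x ≡ true) ⇔ (∃ λ (y : Fin s → Bool) → evalCNF [ x , y ] F ≡ true)

-- A Σ3-circuit on n inputs: an output OR gate fed by nAnd AND gates, which are
-- fed by nOr bottom OR gates (clauses over the input literals).
-- wires i j = true  iff  bottom OR gate j is an input of AND gate i
-- (so bottom gates may be shared between AND gates).
record Σ3Circuit (n : ℕ) : Set where
  field
    nAnd   : ℕ
    nOr    : ℕ
    bottom : Fin nOr → Clause (Fin n)
    wires  : Fin nAnd → Fin nOr → Bool

open Σ3Circuit public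

evalΣ3 : {n : ℕ} → Σ3Circuit n → (Fin n → Bool) → Bool
evalΣ3 C x =
  any (λ i → all (λ j → not (wires C i j) ∨ evalClause x (bottom C j)) (allFin (nOr C)))
      (allFin (nAnd C))

Computes : {n : ℕ} → Σ3Circuit n → BoolFun n → Set
Computes {n} C f = (x : Fin n → Bool) → evalΣ3 C x ≡ f x

-- Σ3(t,r)-circuit: at most t AND gates and at most r bottom OR gates.
-- (We also require the output OR gate to have at least one input, i.e. at
--  least one AND gate.)
IsΣ3Circuit : {n : ℕ} → ℕ → ℕ → Σ3Circuit n → Set
IsΣ3Circuit t r C = (1 ≤ nAnd C) × (nAnd C ≤ t) × (nOr C ≤ r)

-- Formula: every gate has out-degree one.  AND gates feed only the output
-- gate; each bottom OR gate feeds exactly one AND gate.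
IsFormula : {n : ℕ} → Σ3Circuit n → Set
IsFormula C =
  ((j : Fin (nOr C)) → Σ (Fin (nAnd C)) λ i → wires C i j ≡ true)
  × ((j : Fin (nOr C)) (i i' : Fin (nAnd C)) →
       wires C i j ≡ true → wires C i' j ≡ true → i ≡ i')

IsΣ3Formula : {n : ℕ} → ℕ → ℕ → Σ3Circuit n → Set
IsΣ3Formula t r C = IsΣ3Circuit t r C × IsFormula C

module Submission where

-- With s = ⌈log₂ t⌉ non-deterministic variables y, cut {0,1}ˢ into m ≤ 2ˢ
-- disjoint nonempty subcubes B₁, …, Bₘ, one per AND gate.  A wire from bottom
-- clause cⱼ to AND gate i becomes the single clause  cⱼ ∨ ¬Bᵢ  (¬Bᵢ is a
-- disjunction of literals).  For fixed y the CNF then says exactly that the AND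
-- gate whose subcube contains y accepts x, so ∃y F(x, y) iff some AND gate
-- accepts x.  There is one clause per wire: at most r in a formula, where every
-- bottom gate has a single wire, and at most r t in a circuit.

open import Defs
open import Data.Nat using (ℕ; zero; suc; _+_; _*_; _∸_; _^_; _≤_; _<_; z≤n; s≤s; ⌈_/2⌉; ⌊_/2⌋)
open import Data.Nat.Properties
open import Data.Nat.Logarithm using (⌈log₂_⌉)
open import Data.Nat.Logarithm.Core using (⌈log2⌉)
open import Induction.WellFounded using (Acc; acc)
open import Data.Fin using (Fin; zero; suc; toℕ; fromℕ<)
open import Data.Fin.Properties using (toℕ<n; toℕ-fromℕ<; toℕ-injective)
open import Data.Bool using (Bool; true; false; not; _∧_; _∨_)
open import Data.Bool.Properties using (∨-zeroʳ; ∨-identityʳ; ∨-assoc; ∧-conicalˡ; ∧-conicalʳ; not-injective; not-involutive; T-≡; ∨-∧-booleanAlgebra)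
  renaming (_≟_ to _≟ᵇ_)
open import Algebra.Lattice.Properties.BooleanAlgebra ∨-∧-booleanAlgebra using (deMorgan₁)
open import Data.Bool.ListAction using (any; all; and; or)
open import Data.List using (List; []; _∷_; map; _++_; allFin; filter; cartesianProduct; length)
open import Data.List.Properties using (map-∘; length-map; length-++; length-filter; length-tabulate)
open import Data.List.Membership.Propositional using (_∈_; lose)
open import Data.List.Membership.Propositional.Properties
  using (∈-allFin; ∈-map⁺; ∈-map⁻; ∈-filter⁺; ∈-filter⁻; ∈-cartesianProduct⁺)
open import Data.List.Relation.Unary.All using (tabulate; lookup)
open import Data.List.Relation.Unary.All.Properties using (all⁺; all⁻)
open import Data.List.Relation.Unary.Any using (satisfied)
open import Data.List.Relation.Unary.Any.Properties using (any⁺; any⁻)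
open import Data.Product using (_×_; Σ; ∃; _,_; proj₁; proj₂; map₁; map₂)
open import Data.Sum using (_⊎_; inj₁; inj₂; [_,_])
open import Data.Vec.Functional using () renaming (_∷_ to _◂_)
open import Function using (_∘_; id; _⇔_; mk⇔; Equivalence)
open import Relation.Nullary using (¬_; Dec; yes; no; contradiction)
open import Relation.Binary.PropositionalEquality hiding ([_])

n≤2*⌈n/2⌉ : ∀ n → n ≤ 2 * ⌈ n /2⌉
n≤2*⌈n/2⌉ n = begin
  n                       ≡⟨ ⌊n/2⌋+⌈n/2⌉≡n n ⟨
  ⌊ n /2⌋ + ⌈ n /2⌉       ≤⟨ +-monoˡ-≤ ⌈ n /2⌉ (⌊n/2⌋≤⌈n/2⌉ n) ⟩
  ⌈ n /2⌉ + ⌈ n /2⌉       ≡⟨ cong (⌈ n /2⌉ +_) (+-identityʳ ⌈ n /2⌉) ⟨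
  2 * ⌈ n /2⌉             ∎
  where open ≤-Reasoning

n≤2^⌈log2⌉n : ∀ n (rec : Acc _<_ n) → n ≤ 2 ^ ⌈log2⌉ n rec
n≤2^⌈log2⌉n 0 _ = z≤n
n≤2^⌈log2⌉n 1 _ = s≤s z≤n
n≤2^⌈log2⌉n (suc (suc n)) (acc rs) =
  ≤-trans (n≤2*⌈n/2⌉ (suc (suc n))) (*-monoʳ-≤ 2 (n≤2^⌈log2⌉n (suc ⌈ n /2⌉) _))

n≤2^⌈log₂n⌉ : ∀ n → n ≤ 2 ^ ⌈log₂ n ⌉
n≤2^⌈log₂n⌉ n = n≤2^⌈log2⌉n n _

module _ {A : Set} (p : A → Bool) where

  all-true⁺ : ∀ xs → (∀ {a} → a ∈ xs → p a ≡ true) → all p xs ≡ true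
  all-true⁺ xs h = Equivalence.to T-≡ (all⁻ p (tabulate (Equivalence.from T-≡ ∘ h)))

  all-true⁻ : ∀ xs → all p xs ≡ true → ∀ {a} → a ∈ xs → p a ≡ true
  all-true⁻ xs h a∈xs = Equivalence.to T-≡ (lookup (all⁺ p xs (Equivalence.from T-≡ h)) a∈xs)

  any-true⁺ : ∀ {xs a} → a ∈ xs → p a ≡ true → any p xs ≡ true
  any-true⁺ a∈xs pa = Equivalence.to T-≡ (any⁺ p (lose a∈xs (Equivalence.from T-≡ pa)))

  any-true⁻ : ∀ xs → any p xs ≡ true → ∃ λ a → p a ≡ true
  any-true⁻ xs h = map₂ (Equivalence.to T-≡) (satisfied (any⁻ p xs (Equivalence.from T-≡ h)))

  any-++ : ∀ xs ys → any p (xs ++ ys) ≡ any p xs ∨ any p ys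
  any-++ []       ys = refl
  any-++ (x ∷ xs) ys = trans (cong (p x ∨_) (any-++ xs ys)) (sym (∨-assoc (p x) _ _))

length-allFin : ∀ k → length (allFin k) ≡ k
length-allFin k = length-tabulate id

length-cartesianProduct : ∀ {A B : Set} (xs : List A) (ys : List B) →
  length (cartesianProduct xs ys) ≡ length xs * length ys
length-cartesianProduct []       ys = refl
length-cartesianProduct (x ∷ xs) ys = begin
  length (map (x ,_) ys ++ cartesianProduct xs ys)         ≡⟨ length-++ (map (x ,_) ys) ⟩
  length (map (x ,_) ys) + length (cartesianProduct xs ys) ≡⟨ cong₂ _+_ (length-map (x ,_) ys) (length-cartesianProduct xs ys) ⟩
  length ys + length xs * length ys                        ∎
  where open ≡-Reasoning

Term : Set → Set
Term V = List (Literal V)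

evalTerm : {V : Set} → (V → Bool) → Term V → Bool
evalTerm ρ = all (evalLit ρ)

rename : {V W : Set} → (V → W) → List (Literal V) → List (Literal W)
rename g = map (map₁ g)

negation : {V : Set} → Term V → Clause V
negation = map (map₂ not)

implication : {V W : Set} → Term W → Clause V → Clause (V ⊎ W)
implication t c = rename inj₁ c ++ negation (rename inj₂ t)

module _ {V W : Set} (ρ : W → Bool) (g : V → W) where

  evalClause-rename : ∀ c → evalClause ρ (rename g c) ≡ evalClause (ρ ∘ g) c
  evalClause-rename c = cong or (sym (map-∘ c))

  evalTerm-rename : ∀ t → evalTerm ρ (rename g t) ≡ evalTerm (ρ ∘ g) t
  evalTerm-rename t = cong and (sym (map-∘ t))

module _ {V : Set} (ρ : V → Bool) where

  evalLit-not : ∀ v b → evalLit ρ (v , not b) ≡ not (evalLit ρ (v , b))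
  evalLit-not v true  = refl
  evalLit-not v false = sym (not-involutive (ρ v))

  evalClause-negation : ∀ t → evalClause ρ (negation t) ≡ not (evalTerm ρ t)
  evalClause-negation []            = refl
  evalClause-negation ((v , b) ∷ t) = begin
    evalLit ρ (v , not b) ∨ evalClause ρ (negation t)  ≡⟨ cong₂ _∨_ (evalLit-not v b) (evalClause-negation t) ⟩
    not (evalLit ρ (v , b)) ∨ not (evalTerm ρ t)       ≡⟨ deMorgan₁ (evalLit ρ (v , b)) (evalTerm ρ t) ⟨
    not (evalLit ρ (v , b) ∧ evalTerm ρ t)             ∎
    where open ≡-Reasoning

module _ {V W : Set} (x : V → Bool) (y : W → Bool) where

  evalClause-implication : ∀ t c →
    evalClause [ x , y ] (implication t c) ≡ evalClause x c ∨ not (evalTerm y t)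
  evalClause-implication t c =
    trans (any-++ (evalLit [ x , y ]) (rename inj₁ c) (negation (rename inj₂ t)))
          (cong₂ _∨_ (evalClause-rename [ x , y ] inj₁ c)
                     (trans (evalClause-negation [ x , y ] (rename inj₂ t))
                            (cong not (evalTerm-rename [ x , y ] inj₂ t))))

-- Cuts {0,1}ˢ into m ≤ 2ˢ subcubes, indexed by i < m.  If m ≤ 2ˢ⁻¹ the first
-- variable is left free; otherwise y₀ = 0 carries 2ˢ⁻¹ points and y₀ = 1 the
-- remaining m − 2ˢ⁻¹ subcubes.
subcube : (s m i : ℕ) → Term (Fin s)
subcube zero    m i = []
subcube (suc s) m i with m ≤? 2 ^ s | i <? 2 ^ s
... | yes _ | _     = rename suc (subcube s m i)
... | no _  | yes _ = (zero , false) ∷ rename suc (subcube s (2 ^ s) i)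
... | no _  | no _  = (zero , true)  ∷ rename suc (subcube s (m ∸ 2 ^ s) (i ∸ 2 ^ s))

module _ {s m i : ℕ} (y : Fin (suc s) → Bool) where

  evalTerm-subcube-unsplit : m ≤ 2 ^ s →
    evalTerm y (subcube (suc s) m i) ≡ evalTerm (y ∘ suc) (subcube s m i)
  evalTerm-subcube-unsplit m≤ with m ≤? 2 ^ s | i <? 2 ^ s
  ... | yes _  | _ = evalTerm-rename y suc (subcube s m i)
  ... | no m≰ | _ = contradiction m≤ m≰

  evalTerm-subcube-lower : ¬ m ≤ 2 ^ s → i < 2 ^ s →
    evalTerm y (subcube (suc s) m i) ≡ not (y zero) ∧ evalTerm (y ∘ suc) (subcube s (2 ^ s) i)
  evalTerm-subcube-lower m≰ i< with m ≤? 2 ^ s | i <? 2 ^ s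
  ... | yes m≤ | _     = contradiction m≤ m≰
  ... | no _   | yes _ = cong (not (y zero) ∧_) (evalTerm-rename y suc (subcube s (2 ^ s) i))
  ... | no _   | no i≮ = contradiction i< i≮

  evalTerm-subcube-upper : ¬ m ≤ 2 ^ s → ¬ i < 2 ^ s →
    evalTerm y (subcube (suc s) m i) ≡ y zero ∧ evalTerm (y ∘ suc) (subcube s (m ∸ 2 ^ s) (i ∸ 2 ^ s))
  evalTerm-subcube-upper m≰ i≮ with m ≤? 2 ^ s | i <? 2 ^ s
  ... | yes m≤ | _      = contradiction m≤ m≰
  ... | no _   | yes i< = contradiction i< i≮
  ... | no _   | no _   = cong (y zero ∧_) (evalTerm-rename y suc (subcube s (m ∸ 2 ^ s) (i ∸ 2 ^ s)))

evalTerm-◂-rename-suc : ∀ {s} b (y : Fin s → Bool) t → evalTerm (b ◂ y) (rename suc t) ≡ evalTerm y t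
evalTerm-◂-rename-suc b y = evalTerm-rename (b ◂ y) suc

subcube-nonempty : ∀ s m i → ∃ λ y → evalTerm y (subcube s m i) ≡ true
subcube-nonempty zero    m i = (λ ()) , refl
subcube-nonempty (suc s) m i with m ≤? 2 ^ s | i <? 2 ^ s
... | yes _ | _ = let y , e = subcube-nonempty s m i in
  false ◂ y , trans (evalTerm-◂-rename-suc false y (subcube s m i)) e
... | no _  | yes _ = let y , e = subcube-nonempty s (2 ^ s) i in
  false ◂ y , trans (evalTerm-◂-rename-suc false y (subcube s (2 ^ s) i)) e
... | no _  | no _ = let y , e = subcube-nonempty s (m ∸ 2 ^ s) (i ∸ 2 ^ s) in
  true ◂ y , trans (evalTerm-◂-rename-suc true y (subcube s (m ∸ 2 ^ s) (i ∸ 2 ^ s))) e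

m∸2^s≤2^s : ∀ s {m} → m ≤ 2 ^ suc s → m ∸ 2 ^ s ≤ 2 ^ s
m∸2^s≤2^s s {m} m≤ = m≤n+o⇒m∸n≤o m (2 ^ s) (≤-trans m≤ (≤-reflexive (cong (2 ^ s +_) (+-identityʳ (2 ^ s)))))

subcube-covers : ∀ s m → 1 ≤ m → m ≤ 2 ^ s →
  ∀ y → ∃ λ i → i < m × evalTerm y (subcube s m i) ≡ true
subcube-covers zero    m 1≤m _  y = 0 , 1≤m , refl
subcube-covers (suc s) m 1≤m m≤ y = cases (m ≤? 2 ^ s) (y zero) refl
  where
  cases : Dec (m ≤ 2 ^ s) → ∀ b → y zero ≡ b → ∃ λ i → i < m × evalTerm y (subcube (suc s) m i) ≡ true
  cases (yes m≤2^s) _ _ =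
    let i , i<m , e = subcube-covers s m 1≤m m≤2^s (y ∘ suc) in
    i , i<m , trans (evalTerm-subcube-unsplit y m≤2^s) e
  cases (no m≰2^s) false y₀ =
    let i , i<2^s , e = subcube-covers s (2 ^ s) (m^n>0 2 s) ≤-refl (y ∘ suc) in
    i , <-≤-trans i<2^s (<⇒≤ (≰⇒> m≰2^s)) ,
    trans (evalTerm-subcube-lower y m≰2^s i<2^s) (cong₂ (λ b c → not b ∧ c) y₀ e)
  cases (no m≰2^s) true y₀ =
    let i , i<m∸2^s , e = subcube-covers s (m ∸ 2 ^ s) (m<n⇒0<n∸m (≰⇒> m≰2^s)) (m∸2^s≤2^s s m≤) (y ∘ suc) in
    i + 2 ^ s ,
    ≤-trans (+-monoˡ-< (2 ^ s) i<m∸2^s) (≤-reflexive (m∸n+n≡m (<⇒≤ (≰⇒> m≰2^s)))) ,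
    trans (evalTerm-subcube-upper y m≰2^s (λ i+2^s<2^s → <⇒≱ i+2^s<2^s (m≤n+m (2 ^ s) i)))
          (trans (cong₂ (λ b j → b ∧ evalTerm (y ∘ suc) (subcube s (m ∸ 2 ^ s) j)) y₀ (m+n∸n≡m i (2 ^ s))) e)

subcube-disjoint : ∀ s m → m ≤ 2 ^ s → ∀ y {i i'} → i < m → i' < m →
  evalTerm y (subcube s m i) ≡ true → evalTerm y (subcube s m i') ≡ true → i ≡ i'
subcube-disjoint zero m m≤1 y i<m i'<m _ _ =
  trans (n<1⇒n≡0 (≤-trans i<m m≤1)) (sym (n<1⇒n≡0 (≤-trans i'<m m≤1)))
subcube-disjoint (suc s) m m≤ y {i} {i'} i<m i'<m e e' = cases (m ≤? 2 ^ s) (i <? 2 ^ s) (i' <? 2 ^ s)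
  where
  y₀-lower : ∀ {j} → ¬ m ≤ 2 ^ s → j < 2 ^ s → evalTerm y (subcube (suc s) m j) ≡ true → y zero ≡ false
  y₀-lower {j} m≰ j< ej = not-injective (∧-conicalˡ _ _ (trans (sym (evalTerm-subcube-lower y m≰ j<)) ej))

  y₀-upper : ∀ {j} → ¬ m ≤ 2 ^ s → ¬ j < 2 ^ s → evalTerm y (subcube (suc s) m j) ≡ true → y zero ≡ true
  y₀-upper {j} m≰ j≮ ej = ∧-conicalˡ _ _ (trans (sym (evalTerm-subcube-upper y m≰ j≮)) ej)

  cases : Dec (m ≤ 2 ^ s) → Dec (i < 2 ^ s) → Dec (i' < 2 ^ s) → i ≡ i'
  cases (yes m≤2^s) _ _ = subcube-disjoint s m m≤2^s (y ∘ suc) i<m i'<m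
    (trans (sym (evalTerm-subcube-unsplit y m≤2^s)) e) (trans (sym (evalTerm-subcube-unsplit y m≤2^s)) e')
  cases (no m≰) (yes i<) (yes i'<) = subcube-disjoint s (2 ^ s) ≤-refl (y ∘ suc) i< i'<
    (∧-conicalʳ _ _ (trans (sym (evalTerm-subcube-lower y m≰ i<)) e))
    (∧-conicalʳ _ _ (trans (sym (evalTerm-subcube-lower y m≰ i'<)) e'))
  cases (no m≰) (yes i<) (no i'≮) = contradiction (trans (sym (y₀-lower m≰ i< e)) (y₀-upper m≰ i'≮ e')) λ ()
  cases (no m≰) (no i≮) (yes i'<) = contradiction (trans (sym (y₀-lower m≰ i'< e')) (y₀-upper m≰ i≮ e)) λ ()
  cases (no m≰) (no i≮) (no i'≮) = ∸-cancelʳ-≡ (≮⇒≥ i≮) (≮⇒≥ i'≮)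
    (subcube-disjoint s (m ∸ 2 ^ s) (m∸2^s≤2^s s m≤) (y ∘ suc)
      (∸-monoˡ-< i<m (≮⇒≥ i≮)) (∸-monoˡ-< i'<m (≮⇒≥ i'≮))
      (∧-conicalʳ _ _ (trans (sym (evalTerm-subcube-upper y m≰ i≮)) e))
      (∧-conicalʳ _ _ (trans (sym (evalTerm-subcube-upper y m≰ i'≮)) e')))

record SubcubePartition (s m : ℕ) : Set where
  field
    block    : Fin m → Term (Fin s)
    covers   : ∀ y → ∃ λ i → evalTerm y (block i) ≡ true
    disjoint : ∀ y {i i'} → evalTerm y (block i) ≡ true → evalTerm y (block i') ≡ true → i ≡ i'
    nonempty : ∀ i → ∃ λ y → evalTerm y (block i) ≡ true

subcubePartition : ∀ {s m} → 1 ≤ m → m ≤ 2 ^ s → SubcubePartition s m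
subcubePartition {s} {m} 1≤m m≤2^s = record
  { block    = λ i → subcube s m (toℕ i)
  ; covers   = λ y → let i , i<m , e = subcube-covers s m 1≤m m≤2^s y in
      fromℕ< i<m , subst (λ j → evalTerm y (subcube s m j) ≡ true) (sym (toℕ-fromℕ< i<m)) e
  ; disjoint = λ y e e' → toℕ-injective (subcube-disjoint s m m≤2^s y (toℕ<n _) (toℕ<n _) e e')
  ; nonempty = λ i → subcube-nonempty s m (toℕ i)
  }

module _ {n : ℕ} (C : Σ3Circuit n) where

  Wire : Set
  Wire = Fin (nAnd C) × Fin (nOr C)

  Enumerates : List Wire → Set
  Enumerates L = ∀ {i j} → (i , j) ∈ L ⇔ wires C i j ≡ true

  andGate : (Fin n → Bool) → Fin (nAnd C) → Bool
  andGate x i = all (λ j → not (wires C i j) ∨ evalClause x (bottom C j)) (allFin (nOr C))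

  andGate-input : ∀ {x i j} → andGate x i ≡ true → wires C i j ≡ true → evalClause x (bottom C j) ≡ true
  andGate-input {x} {i} {j} gate wire =
    trans (cong (λ b → not b ∨ evalClause x (bottom C j)) (sym wire)) (all-true⁻ _ (allFin (nOr C)) gate (∈-allFin j))

  module _ {s : ℕ} (P : SubcubePartition s (nAnd C)) where
    open SubcubePartition P

    wireClause : Wire → Clause (Fin n ⊎ Fin s)
    wireClause (i , j) = implication (block i) (bottom C j)

    evalCNF-wireClauses : ∀ {L} → Enumerates L → ∀ x y {i} → evalTerm y (block i) ≡ true →
      evalCNF [ x , y ] (map wireClause L) ≡ true ⇔ andGate x i ≡ true
    evalCNF-wireClauses {L} L-wires x y {i} y∈i = mk⇔ sound complete
      where
      sound : evalCNF [ x , y ] (map wireClause L) ≡ true → andGate x i ≡ true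
      sound cnf = all-true⁺ _ (allFin (nOr C)) input
        where
        input : ∀ {j} → j ∈ allFin (nOr C) → not (wires C i j) ∨ evalClause x (bottom C j) ≡ true
        input {j} _ with wires C i j in wire
        ... | false = refl
        ... | true  = trans (sym (∨-identityʳ _)) (begin
          evalClause x (bottom C j) ∨ false                     ≡⟨ cong (λ b → _ ∨ not b) y∈i ⟨
          evalClause x (bottom C j) ∨ not (evalTerm y (block i)) ≡⟨ evalClause-implication x y (block i) (bottom C j) ⟨
          evalClause [ x , y ] (wireClause (i , j))            ≡⟨ all-true⁻ _ (map wireClause L) cnf (∈-map⁺ wireClause (Equivalence.from L-wires wire)) ⟩
          true                                                 ∎)
          where open ≡-Reasoning

      complete : andGate x i ≡ true → evalCNF [ x , y ] (map wireClause L) ≡ true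
      complete gate = all-true⁺ _ (map wireClause L) clause
        where
        clause : ∀ {c} → c ∈ map wireClause L → evalClause [ x , y ] c ≡ true
        clause c∈ with ∈-map⁻ wireClause c∈
        ... | (i' , j) , w∈L , refl =
          trans (evalClause-implication x y (block i') (bottom C j)) (wire-satisfied w∈L)
          where
          wire-satisfied : (i' , j) ∈ L → evalClause x (bottom C j) ∨ not (evalTerm y (block i')) ≡ true
          wire-satisfied w∈L with evalTerm y (block i') in y∈i'
          ... | false = ∨-zeroʳ _
          ... | true with refl ← disjoint y y∈i' y∈i =
            trans (∨-identityʳ _) (andGate-input gate (Equivalence.to L-wires w∈L))

    wireClauses-encode : ∀ {f L} → Computes C f → Enumerates L → Encodes f (map wireClause L)
    wireClauses-encode {f} {L} computes L-wires x = mk⇔ fwd bwd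
      where
      fwd : f x ≡ true → ∃ λ y → evalCNF [ x , y ] (map wireClause L) ≡ true
      fwd fx =
        let i , gate = any-true⁻ (andGate x) (allFin (nAnd C)) (trans (computes x) fx)
            y , y∈i  = nonempty i
        in y , Equivalence.from (evalCNF-wireClauses L-wires x y y∈i) gate

      bwd : (∃ λ y → evalCNF [ x , y ] (map wireClause L) ≡ true) → f x ≡ true
      bwd (y , cnf) =
        let i , y∈i = covers y
        in trans (sym (computes x))
             (any-true⁺ (andGate x) (∈-allFin i) (Equivalence.to (evalCNF-wireClauses L-wires x y y∈i) cnf))

  parentWires : ((j : Fin (nOr C)) → Σ (Fin (nAnd C)) λ i → wires C i j ≡ true) → List Wire
  parentWires parent = map (λ j → proj₁ (parent j) , j) (allFin (nOr C))

  length-parentWires : ∀ parent → length (parentWires parent) ≡ nOr C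
  length-parentWires parent = trans (length-map _ (allFin (nOr C))) (length-allFin (nOr C))

  parentWires-enumerates : (formula : IsFormula C) → Enumerates (parentWires (proj₁ formula))
  parentWires-enumerates (parent , unique) = mk⇔ wired listed
    where
    wired : ∀ {i j} → (i , j) ∈ parentWires parent → wires C i j ≡ true
    wired w∈ with ∈-map⁻ _ w∈
    ... | j , _ , refl = proj₂ (parent j)

    listed : ∀ {i j} → wires C i j ≡ true → (i , j) ∈ parentWires parent
    listed {i} {j} wire with refl ← unique j i (proj₁ (parent j)) wire (proj₂ (parent j)) =
      ∈-map⁺ _ (∈-allFin j)

  allPairs : List Wire
  allPairs = cartesianProduct (allFin (nAnd C)) (allFin (nOr C))

  wired? : (w : Wire) → Dec (wires C (proj₁ w) (proj₂ w) ≡ true)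
  wired? (i , j) = wires C i j ≟ᵇ true

  allWires : List Wire
  allWires = filter wired? allPairs

  allWires-enumerates : Enumerates allWires
  allWires-enumerates {i} {j} = mk⇔
    (λ w∈ → proj₂ (∈-filter⁻ wired? {xs = allPairs} w∈))
    (∈-filter⁺ wired? (∈-cartesianProduct⁺ (∈-allFin i) (∈-allFin j)))

  length-allWires : length allWires ≤ nAnd C * nOr C
  length-allWires = begin
    length allWires                                    ≤⟨ length-filter wired? allPairs ⟩
    length allPairs                                    ≡⟨ length-cartesianProduct (allFin (nAnd C)) (allFin (nOr C)) ⟩
    length (allFin (nAnd C)) * length (allFin (nOr C)) ≡⟨ cong₂ _*_ (length-allFin (nAnd C)) (length-allFin (nOr C)) ⟩
    nAnd C * nOr C                                     ∎
    where open ≤-Reasoning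

wireEncoding : ∀ {n t f k} (C : Σ3Circuit n) → 1 ≤ nAnd C → nAnd C ≤ t → Computes C f →
  ∀ {L} → Enumerates C L → length L ≤ k →
  Σ (CNF (Fin n ⊎ Fin ⌈log₂ t ⌉)) λ F → (length F ≤ k) × Encodes f F
wireEncoding {t = t} C 1≤m m≤t computes {L} L-wires L≤k =
  map (wireClause C P) L ,
  ≤-trans (≤-reflexive (length-map _ L)) L≤k ,
  wireClauses-encode C P computes L-wires
  where
  P = subcubePartition 1≤m (≤-trans m≤t (n≤2^⌈log₂n⌉ t))

lemma3 : {n t r : ℕ} (f : BoolFun n) →
    ((C : Σ3Circuit n) → IsΣ3Formula t r C → Computes C f →
      Σ (CNF (Fin n ⊎ Fin ⌈log₂ t ⌉)) λ F → (length F ≤ r) × Encodes f F)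
    × ((C : Σ3Circuit n) → IsΣ3Circuit t r C → Computes C f →
      Σ (CNF (Fin n ⊎ Fin ⌈log₂ t ⌉)) λ F → (length F ≤ 2 * r * t) × Encodes f F)
lemma3 {n} {t} {r} f = formula , circuit
  where
  formula : (C : Σ3Circuit n) → IsΣ3Formula t r C → Computes C f →
    Σ (CNF (Fin n ⊎ Fin ⌈log₂ t ⌉)) λ F → (length F ≤ r) × Encodes f F
  formula C ((1≤m , m≤t , o≤r) , isFormula) computes =
    wireEncoding C 1≤m m≤t computes (parentWires-enumerates C isFormula)
      (≤-trans (≤-reflexive (length-parentWires C (proj₁ isFormula))) o≤r)

  circuit : (C : Σ3Circuit n) → IsΣ3Circuit t r C → Computes C f →
    Σ (CNF (Fin n ⊎ Fin ⌈log₂ t ⌉)) λ F → (length F ≤ 2 * r * t) × Encodes f F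
  circuit C (1≤m , m≤t , o≤r) computes =
    wireEncoding C 1≤m m≤t computes (allWires-enumerates C) (≤-trans (length-allWires C) m*o≤2rt)
    where
    open ≤-Reasoning
    m*o≤2rt : nAnd C * nOr C ≤ 2 * r * t
    m*o≤2rt = begin
      nAnd C * nOr C ≤⟨ *-mono-≤ m≤t o≤r ⟩
      t * r          ≡⟨ *-comm t r ⟩
      r * t          ≤⟨ m≤n*m (r * t) 2 ⟩
      2 * (r * t)    ≡⟨ *-assoc 2 r t ⟨
      2 * r * t      ∎
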